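{- Let $r\ge1$ be an integer and let $A,B$ be $n\times n$ doubly stochastic matrices all of whose entries are multiples of $1/r$. Then $\mathrm{d}_{\mathrm{KT}}(A,B)\le2r^2\cdot\mathrm{d}_{\mathrm{FR}}(A,B)$, where $\mathrm{d}_{\mathrm{KT}}$ is the fractional Kendall-Tau distance.
   Context: Matrices have rows indexed by a finite set $U$ of $n$ elements and columns by positions $1,\ldots,n$; doubly stochastic means nonnegative with all row and column sums equal to $1$. The $r$-index of $e\in U$ in $A$ is $I^A_e=\min\{1\le i\le n:\sum_{s=1}^iA_{es}\ge1/r\}$. For doubly stochastic $A,B$, a pair $(e,e')$ of distinct elements is inverted if one of the following holds: $I^A_e>I^A_{e'}$ and $I^B_e<I^B_{e'}$; or $I^A_e<I^A_{e'}$ and $I^B_e>I^B_{e'}$; or $I^A_e=I^A_{e'}$ and $I^B_e\ne I^B_{e'}$; or $I^A_e\ne I^A_{e'}$ and $I^B_e=I^B_{e'}$. The fractional Kendall-Tau distance $\mathrm{d}_{\mathrm{KT}}(A,B)$ is the number of inverted (unordered) pairs. $\mathrm{d}_{\mathrm{FR}}(A,B)$ is the optimal value of the transportation LP: minimize $\sum_{e}\sum_{i,j=1}^n|i-j|f^e_{ij}$ s.t. $\sum_i f^e_{ij}=B_{ej}$ for all $e,j$, $\sum_j f^e_{ij}=A_{ei}$ for all $e,i$, $f^e_{ij}\ge0$.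
   Formalization: The flows $f^e_{ij}$ of the transportation LP defining $\mathrm{d}_{\mathrm{FR}}(A,B)$ take values in ℚ, and the bound is asserted against the cost of each rational feasible flow. -}

module Defs where

open import Data.Nat as ℕ using (ℕ; zero; suc; NonZero; ∣_-_∣)
open import Data.Fin using (Fin; toℕ)
import Data.Fin as F
open import Data.Bool using (Bool; true; false; if_then_else_; _∧_; _∨_; not)
open import Data.Integer using (+_)
open import Data.Rational using (ℚ; 0ℚ; 1ℚ; _+_; _*_; _≤_; _/_)
open import Data.Rational.Properties using (_≤?_)
open import Data.Product using (∃; _×_)
open import Relation.Nullary.Decidable using (⌊_⌋)
open import Relation.Binary.PropositionalEquality using (_≡_)

-- Matrices: rows indexed by U = Fin n (the n elements), columns by positions.
-- Column/position s : Fin n stands for position toℕ s + 1.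
Matrix : ℕ → Set
Matrix n = Fin n → Fin n → ℚ

Σ : (n : ℕ) → (Fin n → ℚ) → ℚ
Σ zero    f = 0ℚ
Σ (suc n) f = f F.zero + Σ n (λ i → f (F.suc i))

Σℕ : (n : ℕ) → (Fin n → ℕ) → ℕ
Σℕ zero    f = 0
Σℕ (suc n) f = f F.zero ℕ.+ Σℕ n (λ i → f (F.suc i))

DoublyStochastic : (n : ℕ) → Matrix n → Set
DoublyStochastic n A =
  (∀ e s → 0ℚ ≤ A e s) ×
  (∀ e → Σ n (λ s → A e s) ≡ 1ℚ) ×
  (∀ s → Σ n (λ e → A e s) ≡ 1ℚ)

EntriesMultipleOf1/ : (r : ℕ) .{{_ : NonZero r}} → (n : ℕ) → Matrix n → Set
EntriesMultipleOf1/ r n A = ∀ e s → ∃ λ (k : ℕ) → A e s ≡ (+ k) / r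

-- prefix sum  Σ_{s=1}^{i} A_{es}  (positions are 1-based)
prefix : (n : ℕ) → Matrix n → Fin n → ℕ → ℚ
prefix n A e i = Σ n (λ s → if ⌊ suc (toℕ s) ℕ.≤? i ⌋ then A e s else 0ℚ)

-- least i ∈ {1,…,m} with p i = true (returns m+1 if there is none)
firstFrom1 : (m : ℕ) → (ℕ → Bool) → ℕ
firstFrom1 zero    p = 1
firstFrom1 (suc m) p = if p 1 then 1 else suc (firstFrom1 m (λ i → p (suc i)))

rIndex : (r : ℕ) .{{_ : NonZero r}} → (n : ℕ) → Matrix n → Fin n → ℕ
rIndex r n A e = firstFrom1 n (λ i → ⌊ (+ 1) / r ≤? prefix n A e i ⌋)

inverted : (r : ℕ) .{{_ : NonZero r}} → (n : ℕ) → Matrix n → Matrix n → Fin n → Fin n → Bool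
inverted r n A B e e' =
     (⌊ a' ℕ.<? a ⌋ ∧ ⌊ b ℕ.<? b' ⌋)
  ∨ (⌊ a ℕ.<? a' ⌋ ∧ ⌊ b' ℕ.<? b ⌋)
  ∨ (⌊ a ℕ.≟ a' ⌋ ∧ not ⌊ b ℕ.≟ b' ⌋)
  ∨ (not ⌊ a ℕ.≟ a' ⌋ ∧ ⌊ b ℕ.≟ b' ⌋)
  where
    a  = rIndex r n A e
    a' = rIndex r n A e'
    b  = rIndex r n B e
    b' = rIndex r n B e'

-- fractional Kendall–Tau distance: number of unordered pairs {e,e'}, e ≠ e',
-- that are inverted (each unordered pair counted once via toℕ e < toℕ e')
dKT : (r : ℕ) .{{_ : NonZero r}} → (n : ℕ) → Matrix n → Matrix n → ℕ
dKT r n A B = Σℕ n (λ e → Σℕ n (λ e' →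
  if ⌊ toℕ e ℕ.<? toℕ e' ⌋ ∧ inverted r n A B e e' then 1 else 0))

Flow : ℕ → Set
Flow n = Fin n → Fin n → Fin n → ℚ

-- feasibility for the transportation LP defining d_FR(A,B)
FeasibleFlow : (n : ℕ) → Matrix n → Matrix n → Flow n → Set
FeasibleFlow n A B f =
  (∀ e i j → 0ℚ ≤ f e i j) ×
  (∀ e j → Σ n (λ i → f e i j) ≡ B e j) ×
  (∀ e i → Σ n (λ j → f e i j) ≡ A e i)

flowCost : (n : ℕ) → Flow n → ℚ
flowCost n f = Σ n (λ e → Σ n (λ i → Σ n (λ j →
  ((+ ∣ toℕ i - toℕ j ∣) / 1) * f e i j)))

-- All entries being multiples of 1/r, row e of a matrix vanishes before its r-index I_e and
-- carries mass ≥ 1/r at I_e; as column sums are 1, at most r elements share a value of I.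
-- The flow must carry the mass ≥ 1/r of row e of A at I^A_e to positions ≥ I^B_e, where row e
-- of B lives (or symmetrically), so Σ_e |I^A_e − I^B_e| ≤ r · cost(f).
-- Give the ordered pair (e, e') the weight: number of the indices I^A_e', I^B_e' lying on the
-- segment between I^A_e and I^B_e, if that segment is non-degenerate. An inverted pair has total
-- weight ≥ 2 in its two orders, while a segment of length d ≥ 1 meets indices of at most
-- 2r(d + 1) ≤ 4rd elements. Hence 2 d_KT ≤ 4r Σ_e |I^A_e − I^B_e| ≤ 4r² cost(f).
module Submission where

open import Defs
open import Data.Nat using (ℕ; NonZero)
import Data.Nat
import Data.Nat.Properties as ℕP
open import Data.Fin as Fin using (Fin; toℕ)
import Data.Fin.Properties as FinP
open import Data.Bool using (Bool; true; false; T; if_then_else_; _∧_; _∨_; not)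
open import Data.Bool.Properties using (T-∧; T-∨)
open import Data.Product as Prod using (Σ-syntax; _×_; _,_; proj₁; proj₂)
open import Data.Sum as Sum using (_⊎_; inj₁; inj₂)
open import Data.Unit using (tt)
open import Data.Empty using (⊥-elim)
open import Function using (_∘_; Equivalence; mk⇔)
open import Relation.Nullary using (Dec; yes; no; ¬_; ¬?; _×-dec_; contradiction)
open import Relation.Nullary.Decidable using (⌊_⌋; toWitness; fromWitness; toWitnessFalse; isYes≗does; does-⇔)
open import Relation.Binary.PropositionalEquality
open import Algebra.Properties.Semiring.Sum ℕP.+-*-semiring
  using (sum-syntax; sum-cong-≗; sum-replicate-zero; ∑-distrib-+; ∑-comm; *-distribˡ-sum)

open Equivalence using (to)

⟦_⟧ : Bool → ℕ
⟦ b ⟧ = if b then 1 else 0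

module Counting where

  open Data.Nat using (zero; suc; z≤n; _≤_; _+_; _*_)
  open ℕP using (≤-refl; ≤-trans; ≤-reflexive)

  ⟦⟧≤1 : ∀ b → ⟦ b ⟧ ≤ 1
  ⟦⟧≤1 true  = ≤-refl
  ⟦⟧≤1 false = z≤n

  ⟦⌊⌋⟧-mono : ∀ {P Q : Set} (p : Dec P) (q : Dec Q) → (P → Q) → ⟦ ⌊ p ⌋ ⟧ ≤ ⟦ ⌊ q ⌋ ⟧
  ⟦⌊⌋⟧-mono (yes p) (yes _) _   = ≤-refl
  ⟦⌊⌋⟧-mono (yes p) (no ¬q) P⇒Q = contradiction (P⇒Q p) ¬q
  ⟦⌊⌋⟧-mono (no _)  _       _   = z≤n

  ⟦⌊⌋⟧≡1 : ∀ {P : Set} (p : Dec P) → P → ⟦ ⌊ p ⌋ ⟧ ≡ 1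
  ⟦⌊⌋⟧≡1 (yes _) _ = refl
  ⟦⌊⌋⟧≡1 (no ¬p) p = contradiction p ¬p

  ⟦⌊⌋⟧≡0 : ∀ {P : Set} (p : Dec P) → ¬ P → ⟦ ⌊ p ⌋ ⟧ ≡ 0
  ⟦⌊⌋⟧≡0 (yes p) ¬p = contradiction p ¬p
  ⟦⌊⌋⟧≡0 (no _)  _  = refl

  Σℕ≡∑ : ∀ n (f : Fin n → ℕ) → Σℕ n f ≡ ∑[ i < n ] f i
  Σℕ≡∑ zero    f = refl
  Σℕ≡∑ (suc n) f = cong (f Fin.zero +_) (Σℕ≡∑ n (f ∘ Fin.suc))

  ∑-mono-≤ : ∀ n {f g : Fin n → ℕ} → (∀ i → f i ≤ g i) → ∑[ i < n ] f i ≤ ∑[ i < n ] g i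
  ∑-mono-≤ zero    f≤g = z≤n
  ∑-mono-≤ (suc n) f≤g = ℕP.+-mono-≤ (f≤g Fin.zero) (∑-mono-≤ n (f≤g ∘ Fin.suc))

  ∑⟦⌊⌋⟧-none : ∀ n {P : Fin n → Set} (p : ∀ i → Dec (P i)) → (∀ i → ¬ P i) → ∑[ i < n ] ⟦ ⌊ p i ⌋ ⟧ ≡ 0
  ∑⟦⌊⌋⟧-none n p ¬P = trans (sum-cong-≗ (λ i → ⟦⌊⌋⟧≡0 (p i) (¬P i))) (sum-replicate-zero n)

  ∑∑ : ∀ n → (Fin n → Fin n → ℕ) → ℕ
  ∑∑ n F = ∑[ e < n ] ∑[ e' < n ] F e e'

  ΣℕΣℕ≡∑∑ : ∀ n (F : Fin n → Fin n → ℕ) → Σℕ n (λ e → Σℕ n (F e)) ≡ ∑∑ n F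
  ΣℕΣℕ≡∑∑ n F = trans (Σℕ≡∑ n (λ e → Σℕ n (F e))) (sum-cong-≗ (λ e → Σℕ≡∑ n (F e)))

  ∑∑-mono-≤ : ∀ n {F G : Fin n → Fin n → ℕ} → (∀ e e' → F e e' ≤ G e e') → ∑∑ n F ≤ ∑∑ n G
  ∑∑-mono-≤ n F≤G = ∑-mono-≤ n (λ e → ∑-mono-≤ n (F≤G e))

  ∑∑-cong : ∀ n {F G : Fin n → Fin n → ℕ} → (∀ e e' → F e e' ≡ G e e') → ∑∑ n F ≡ ∑∑ n G
  ∑∑-cong n F≡G = sum-cong-≗ (λ e → sum-cong-≗ (F≡G e))

  ∑∑-distrib-+ : ∀ n (F G : Fin n → Fin n → ℕ) → ∑∑ n (λ e e' → F e e' + G e e') ≡ ∑∑ n F + ∑∑ n G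
  ∑∑-distrib-+ n F G = trans (sum-cong-≗ (λ e → ∑-distrib-+ (F e) (G e))) (∑-distrib-+ (λ e → ∑[ e' < n ] F e e') _)

  *-distribˡ-∑∑ : ∀ n c (F : Fin n → Fin n → ℕ) → c * ∑∑ n F ≡ ∑∑ n (λ e e' → c * F e e')
  *-distribˡ-∑∑ n c F = trans (*-distribˡ-sum c (λ e → ∑[ e' < n ] F e e')) (sum-cong-≗ (λ e → *-distribˡ-sum c (F e)))

module Inversions where

  open Counting
  open Data.Nat using (zero; suc; z≤n; s≤s; _≤_; _<_; _+_; _*_; _⊓_; _⊔_; ∣_-_∣; _≟_; _≤?_; _<?_)
  open ℕP using (≤-refl; ≤-trans; ≤-reflexive; <⇒≤; <⇒≢; ≤-<-trans; <-≤-trans; +-mono-≤; m≤m+n; m≤n+m)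
  open import Data.Nat.Tactic.RingSolver using (solve-∀)

  Between : ℕ → ℕ → ℕ → Set
  Between x a b = a ⊓ b ≤ x × x ≤ a ⊔ b

  between? : ∀ x a b → Dec (Between x a b)
  between? x a b = (a ⊓ b ≤? x) ×-dec (x ≤? a ⊔ b)

  ≤-between : ∀ {x a b} → a ≤ x → x ≤ b → Between x a b
  ≤-between {a = a} {b} a≤x x≤b = ≤-trans (ℕP.m⊓n≤m a b) a≤x , ≤-trans x≤b (ℕP.m≤n⊔m a b)

  ≥-between : ∀ {x a b} → b ≤ x → x ≤ a → Between x a b
  ≥-between {a = a} {b} b≤x x≤a = ≤-trans (ℕP.m⊓n≤n a b) b≤x , ≤-trans x≤a (ℕP.m≤m⊔n a b)

  between-left : ∀ a b → Between a a b
  between-left a b = ℕP.m⊓n≤m a b , ℕP.m≤m⊔n a b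

  between-comm : ∀ {x a b} → Between x a b → Between x b a
  between-comm {a = a} {b} = Prod.map (subst (_≤ _) (ℕP.⊓-comm a b)) (subst (_ ≤_) (ℕP.⊔-comm a b))

  ⊔≤⊓+∣-∣ : ∀ a b → a ⊔ b ≤ a ⊓ b + ∣ a - b ∣
  ⊔≤⊓+∣-∣ a b with ℕP.≤-total a b
  ... | inj₁ a≤b rewrite ℕP.m≤n⇒m⊔n≡n a≤b | ℕP.m≤n⇒m⊓n≡m a≤b = ℕP.m≤n+∣n-m∣ b a
  ... | inj₂ b≤a rewrite ℕP.m≥n⇒m⊔n≡m b≤a | ℕP.m≥n⇒m⊓n≡n b≤a = ℕP.m≤n+∣m-n∣ a b

  hit : ℕ → ℕ → ℕ → ℕ
  hit x a b = ⟦ ⌊ ¬? (a ≟ b) ×-dec between? x a b ⌋ ⟧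

  hit≥1 : ∀ {x a b} → a ≢ b → Between x a b → 1 ≤ hit x a b
  hit≥1 {x} {a} {b} a≢b x∈[a,b] = ≤-reflexive (sym (⟦⌊⌋⟧≡1 (¬? (a ≟ b) ×-dec between? x a b) (a≢b , x∈[a,b])))

  hit-comm : ∀ x a b → hit x a b ≡ hit x b a
  hit-comm x a b = cong ⟦_⟧ (trans (isYes≗does p) (trans (does-⇔ (mk⇔ swap swap) p q) (sym (isYes≗does q))))
    where
    p = ¬? (a ≟ b) ×-dec between? x a b
    q = ¬? (b ≟ a) ×-dec between? x b a
    swap : ∀ {a b} → a ≢ b × Between x a b → b ≢ a × Between x b a
    swap (a≢b , x∈[a,b]) = a≢b ∘ sym , between-comm x∈[a,b]

  weight : ℕ → ℕ → ℕ → ℕ → ℕ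
  weight a b a' b' = hit a' a b + hit b' a b

  pairWeight : ℕ → ℕ → ℕ → ℕ → ℕ
  pairWeight a b a' b' = weight a b a' b' + weight a' b' a b

  pairWeight-comm : ∀ a b a' b' → pairWeight a b a' b' ≡ pairWeight a' b' a b
  pairWeight-comm a b a' b' = ℕP.+-comm (weight a b a' b') (weight a' b' a b)

  pairWeight-swap : ∀ a b a' b' → pairWeight a b a' b' ≡ pairWeight b a b' a'
  pairWeight-swap a b a' b' = cong₂ _+_ (weight-swap a b a' b') (weight-swap a' b' a b)
    where
    weight-swap : ∀ a b a' b' → weight a b a' b' ≡ weight b a b' a'
    weight-swap a b a' b' = trans (cong₂ _+_ (hit-comm a' a b) (hit-comm b' a b)) (ℕP.+-comm (hit a' b a) (hit b' b a))

  private
    [w+x]+[y+z]≡[w+z]+[x+y] : ∀ w x y z → (w + x) + (y + z) ≡ (w + z) + (x + y)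
    [w+x]+[y+z]≡[w+z]+[x+y] = solve-∀

  -- Each of the two sums is ≥ 1 by totality of ≤: either b ≤ a' (then a' ∈ [b,a]) or a' ≤ b (then b ∈ [a',b']).
  pairWeight-crossing : ∀ {a b a' b'} → a' < a → b < b' → 2 ≤ pairWeight a b a' b'
  pairWeight-crossing {a} {b} {a'} {b'} a'<a b<b' =
    subst (2 ≤_) (sym ([w+x]+[y+z]≡[w+z]+[x+y] (hit a' a b) (hit b' a b) (hit a a' b') (hit b a' b'))) (+-mono-≤ left right)
    where
    left : 1 ≤ hit a' a b + hit b a' b'
    left with ℕP.≤-total b a'
    ... | inj₁ b≤a' = ≤-trans (hit≥1 (<⇒≢ (≤-<-trans b≤a' a'<a) ∘ sym) (≥-between b≤a' (<⇒≤ a'<a))) (m≤m+n _ _)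
    ... | inj₂ a'≤b = ≤-trans (hit≥1 (<⇒≢ (≤-<-trans a'≤b b<b')) (≤-between a'≤b (<⇒≤ b<b'))) (m≤n+m _ _)
    right : 1 ≤ hit b' a b + hit a a' b'
    right with ℕP.≤-total b' a
    ... | inj₁ b'≤a = ≤-trans (hit≥1 (<⇒≢ (<-≤-trans b<b' b'≤a) ∘ sym) (≥-between (<⇒≤ b<b') b'≤a)) (m≤m+n _ _)
    ... | inj₂ a≤b' = ≤-trans (hit≥1 (<⇒≢ (<-≤-trans a'<a a≤b')) (≤-between (<⇒≤ a'<a) a≤b')) (m≤n+m _ _)

  pairWeight-tie : ∀ a b b' → b ≢ b' → 2 ≤ pairWeight a b a b'
  pairWeight-tie a b b' b≢b' = cases (a ≟ b) (a ≟ b')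
    where
    cases : Dec (a ≡ b) → Dec (a ≡ b') → 2 ≤ pairWeight a b a b'
    cases (yes refl) _ = ≤-trans
      (+-mono-≤ (hit≥1 b≢b' (between-left a b')) (hit≥1 b≢b' (between-left a b')))
      (m≤n+m (weight a b' a a) (weight a a a b'))
    cases (no a≢b) (yes refl) = ≤-trans
      (+-mono-≤ (hit≥1 a≢b (between-left a b)) (hit≥1 a≢b (between-left a b)))
      (m≤m+n (weight a b a a) (weight a a a b))
    cases (no a≢b) (no a≢b') =
      +-mono-≤ (≤-trans (hit≥1 a≢b (between-left a b)) (m≤m+n (hit a a b) (hit b' a b)))
               (≤-trans (hit≥1 a≢b' (between-left a b')) (m≤m+n (hit a a b') (hit b a b')))

  Inverted : ℕ → ℕ → ℕ → ℕ → Set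
  Inverted a a' b b' = (a' < a × b < b') ⊎ (a < a' × b' < b) ⊎ (a ≡ a' × b ≢ b') ⊎ (a ≢ a' × b ≡ b')

  T-inverted : ∀ a a' b b' →
    T ((⌊ a' <? a ⌋ ∧ ⌊ b <? b' ⌋) ∨ (⌊ a <? a' ⌋ ∧ ⌊ b' <? b ⌋) ∨
       (⌊ a ≟ a' ⌋ ∧ not ⌊ b ≟ b' ⌋) ∨ (not ⌊ a ≟ a' ⌋ ∧ ⌊ b ≟ b' ⌋)) →
    Inverted a a' b b'
  T-inverted a a' b b' h with to T-∨ h
  ... | inj₁ h₁ = inj₁ (Prod.map (toWitness {a? = a' <? a}) (toWitness {a? = b <? b'}) (to T-∧ h₁))
  ... | inj₂ h₁ with to T-∨ h₁
  ... | inj₁ h₂ = inj₂ (inj₁ (Prod.map (toWitness {a? = a <? a'}) (toWitness {a? = b' <? b}) (to T-∧ h₂)))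
  ... | inj₂ h₂ with to T-∨ h₂
  ... | inj₁ h₃ = inj₂ (inj₂ (inj₁ (Prod.map (toWitness {a? = a ≟ a'}) (toWitnessFalse {a? = b ≟ b'}) (to T-∧ h₃))))
  ... | inj₂ h₃ = inj₂ (inj₂ (inj₂ (Prod.map (toWitnessFalse {a? = a ≟ a'}) (toWitness {a? = b ≟ b'}) (to T-∧ h₃))))

  inverted⇒pairWeight≥2 : ∀ {a a' b b'} → Inverted a a' b b' → 2 ≤ pairWeight a b a' b'
  inverted⇒pairWeight≥2 {a} {a'} {b} {b'} (inj₁ (a'<a , b<b')) = pairWeight-crossing a'<a b<b'
  inverted⇒pairWeight≥2 {a} {a'} {b} {b'} (inj₂ (inj₁ (a<a' , b'<b))) =
    subst (2 ≤_) (pairWeight-comm a' b' a b) (pairWeight-crossing a<a' b'<b)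
  inverted⇒pairWeight≥2 {a} {_} {b} {b'} (inj₂ (inj₂ (inj₁ (refl , b≢b')))) = pairWeight-tie a b b' b≢b'
  inverted⇒pairWeight≥2 {a} {a'} {b} {_} (inj₂ (inj₂ (inj₂ (a≢a' , refl)))) =
    subst (2 ≤_) (sym (pairWeight-swap a b a' b)) (pairWeight-tie b a a' a≢a')

  FibresAtMost : ∀ {n} → ℕ → (Fin n → ℕ) → Set
  FibresAtMost {n} R g = ∀ c → ∑[ e < n ] ⟦ ⌊ g e ≟ c ⌋ ⟧ ≤ R

  module _ {n R} {g : Fin n → ℕ} (fibres : FibresAtMost R g) where

    ∑-range-≤ : ∀ L lo hi → hi ≤ lo + L → ∑[ e < n ] ⟦ ⌊ (lo ≤? g e) ×-dec (g e ≤? hi) ⌋ ⟧ ≤ suc L * R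
    ∑-range-≤ zero lo hi hi≤lo+0 = ≤-trans (∑-mono-≤ n in-range⇒≡lo) (≤-trans (fibres lo) (m≤m+n R 0))
      where
      in-range⇒≡lo : ∀ e → ⟦ ⌊ (lo ≤? g e) ×-dec (g e ≤? hi) ⌋ ⟧ ≤ ⟦ ⌊ g e ≟ lo ⌋ ⟧
      in-range⇒≡lo e = ⟦⌊⌋⟧-mono _ (g e ≟ lo) λ (lo≤ge , ge≤hi) →
        ℕP.≤-antisym (≤-trans ge≤hi (subst (hi ≤_) (ℕP.+-identityʳ lo) hi≤lo+0)) lo≤ge
    ∑-range-≤ (suc L) lo hi hi≤lo+1+L = begin
      ∑[ e < n ] ⟦ ⌊ (lo ≤? g e) ×-dec (g e ≤? hi) ⌋ ⟧
        ≤⟨ ∑-mono-≤ n split ⟩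
      ∑[ e < n ] (⟦ ⌊ g e ≟ lo ⌋ ⟧ + ⟦ ⌊ (suc lo ≤? g e) ×-dec (g e ≤? hi) ⌋ ⟧)
        ≡⟨ ∑-distrib-+ (λ e → ⟦ ⌊ g e ≟ lo ⌋ ⟧) (λ e → ⟦ ⌊ (suc lo ≤? g e) ×-dec (g e ≤? hi) ⌋ ⟧) ⟩
      ∑[ e < n ] ⟦ ⌊ g e ≟ lo ⌋ ⟧ + ∑[ e < n ] ⟦ ⌊ (suc lo ≤? g e) ×-dec (g e ≤? hi) ⌋ ⟧
        ≤⟨ +-mono-≤ (fibres lo) (∑-range-≤ L (suc lo) hi (subst (hi ≤_) (ℕP.+-suc lo L) hi≤lo+1+L)) ⟩
      R + suc L * R ∎
      where
      open ℕP.≤-Reasoning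
      split : ∀ e → ⟦ ⌊ (lo ≤? g e) ×-dec (g e ≤? hi) ⌋ ⟧
                  ≤ ⟦ ⌊ g e ≟ lo ⌋ ⟧ + ⟦ ⌊ (suc lo ≤? g e) ×-dec (g e ≤? hi) ⌋ ⟧
      split e with g e ≟ lo
      ... | yes _    = ≤-trans (⟦⟧≤1 _) (m≤m+n 1 _)
      ... | no ge≢lo = ⟦⌊⌋⟧-mono _ _ λ (lo≤ge , ge≤hi) → ℕP.≤∧≢⇒< lo≤ge (ge≢lo ∘ sym) , ge≤hi

    ∑-hit-≤ : ∀ a b → ∑[ e < n ] hit (g e) a b ≤ 2 * R * ∣ a - b ∣
    ∑-hit-≤ a b = cases (a ≟ b)
      where
      open ℕP.≤-Reasoning
      [d+d]*R≡2*R*d : ∀ d R → (d + d) * R ≡ 2 * R * d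
      [d+d]*R≡2*R*d = solve-∀
      cases : Dec (a ≡ b) → ∑[ e < n ] hit (g e) a b ≤ 2 * R * ∣ a - b ∣
      cases (yes refl) = ≤-trans (≤-reflexive (∑⟦⌊⌋⟧-none n _ λ _ (a≢a , _) → a≢a refl)) z≤n
      cases (no a≢b) = begin
        ∑[ e < n ] hit (g e) a b               ≤⟨ ∑-mono-≤ n (λ e → ⟦⌊⌋⟧-mono _ _ proj₂) ⟩
        ∑[ e < n ] ⟦ ⌊ between? (g e) a b ⌋ ⟧  ≤⟨ ∑-range-≤ ∣ a - b ∣ (a ⊓ b) (a ⊔ b) (⊔≤⊓+∣-∣ a b) ⟩
        suc ∣ a - b ∣ * R                      ≤⟨ ℕP.*-monoˡ-≤ R (ℕP.+-monoˡ-≤ ∣ a - b ∣ 1≤∣a-b∣) ⟩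
        (∣ a - b ∣ + ∣ a - b ∣) * R            ≡⟨ [d+d]*R≡2*R*d ∣ a - b ∣ R ⟩
        2 * R * ∣ a - b ∣                      ∎
        where
        1≤∣a-b∣ : 1 ≤ ∣ a - b ∣
        1≤∣a-b∣ = ℕP.n≢0⇒n>0 (a≢b ∘ ℕP.∣m-n∣≡0⇒m≡n)

  ∑-weight-≤ : ∀ {n R} {g h : Fin n → ℕ} → FibresAtMost R g → FibresAtMost R h →
               ∀ a b → ∑[ e < n ] weight a b (g e) (h e) ≤ 4 * R * ∣ a - b ∣
  ∑-weight-≤ {n} {R} {g} {h} g-fibres h-fibres a b = begin
    ∑[ e < n ] (hit (g e) a b + hit (h e) a b)
      ≡⟨ ∑-distrib-+ (λ e → hit (g e) a b) (λ e → hit (h e) a b) ⟩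
    ∑[ e < n ] hit (g e) a b + ∑[ e < n ] hit (h e) a b
      ≤⟨ +-mono-≤ (∑-hit-≤ {g = g} g-fibres a b) (∑-hit-≤ {g = h} h-fibres a b) ⟩
    2 * R * ∣ a - b ∣ + 2 * R * ∣ a - b ∣
      ≡⟨ 2Rd+2Rd≡4Rd R ∣ a - b ∣ ⟩
    4 * R * ∣ a - b ∣
      ∎
    where
    open ℕP.≤-Reasoning
    2Rd+2Rd≡4Rd : ∀ R d → 2 * R * d + 2 * R * d ≡ 4 * R * d
    2Rd+2Rd≡4Rd = solve-∀

  ⟦<⟧+⟦>⟧≤1 : ∀ x y → ⟦ ⌊ x <? y ⌋ ⟧ + ⟦ ⌊ y <? x ⌋ ⟧ ≤ 1
  ⟦<⟧+⟦>⟧≤1 x y with x <? y | y <? x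
  ... | yes x<y | yes y<x = contradiction y<x (ℕP.<-asym x<y)
  ... | yes _   | no _    = ≤-refl
  ... | no _    | _       = ⟦⟧≤1 _

  ∑∑-ordered-≤ : ∀ n (F : Fin n → Fin n → ℕ) →
                 ∑∑ n (λ e e' → ⟦ ⌊ toℕ e <? toℕ e' ⌋ ⟧ * (F e e' + F e' e)) ≤ ∑∑ n F
  ∑∑-ordered-≤ n F = begin
    ∑∑ n (λ e e' → before e e' * (F e e' + F e' e))
      ≡⟨ ∑∑-cong n (λ e e' → ℕP.*-distribˡ-+ (before e e') (F e e') (F e' e)) ⟩
    ∑∑ n (λ e e' → before e e' * F e e' + before e e' * F e' e)
      ≡⟨ ∑∑-distrib-+ n _ _ ⟩
    ∑∑ n (λ e e' → before e e' * F e e') + ∑∑ n (λ e e' → before e e' * F e' e)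
      ≡⟨ cong (∑∑ n (λ e e' → before e e' * F e e') +_) (∑-comm (λ e e' → before e e' * F e' e)) ⟩
    ∑∑ n (λ e e' → before e e' * F e e') + ∑∑ n (λ e e' → before e' e * F e e')
      ≡⟨ ∑∑-distrib-+ n _ _ ⟨
    ∑∑ n (λ e e' → before e e' * F e e' + before e' e * F e e')
      ≤⟨ ∑∑-mono-≤ n at-most-once ⟩
    ∑∑ n F
      ∎
    where
    open ℕP.≤-Reasoning
    before : Fin n → Fin n → ℕ
    before e e' = ⟦ ⌊ toℕ e <? toℕ e' ⌋ ⟧
    at-most-once : ∀ e e' → before e e' * F e e' + before e' e * F e e' ≤ F e e'
    at-most-once e e' = begin
      before e e' * F e e' + before e' e * F e e' ≡⟨ ℕP.*-distribʳ-+ (F e e') (before e e') (before e' e) ⟨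
      (before e e' + before e' e) * F e e'        ≤⟨ ℕP.*-monoˡ-≤ (F e e') (⟦<⟧+⟦>⟧≤1 (toℕ e) (toℕ e')) ⟩
      1 * F e e'                                  ≡⟨ ℕP.*-identityˡ (F e e') ⟩
      F e e'                                      ∎

  2⟦∧⟧≤⟦⟧* : ∀ c v x → (T v → 2 ≤ x) → 2 * ⟦ c ∧ v ⟧ ≤ ⟦ c ⟧ * x
  2⟦∧⟧≤⟦⟧* false v     x _  = z≤n
  2⟦∧⟧≤⟦⟧* true  false x _  = z≤n
  2⟦∧⟧≤⟦⟧* true  true  x v⇒ = ≤-trans (v⇒ tt) (≤-reflexive (sym (ℕP.*-identityˡ x)))

  inversions-≤ : ∀ {n} R (a b : Fin n → ℕ) (inv : Fin n → Fin n → Bool) →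
    FibresAtMost R a → FibresAtMost R b →
    (∀ e e' → T (inv e e') → Inverted (a e) (a e') (b e) (b e')) →
    ∑∑ n (λ e e' → ⟦ ⌊ toℕ e <? toℕ e' ⌋ ∧ inv e e' ⟧) ≤ 2 * R * ∑[ e < n ] ∣ a e - b e ∣
  inversions-≤ {n} R a b inv a-fibres b-fibres inverted = ℕP.*-cancelˡ-≤ 2 (begin
    2 * ∑∑ n (λ e e' → ⟦ ⌊ toℕ e <? toℕ e' ⌋ ∧ inv e e' ⟧)
      ≡⟨ *-distribˡ-∑∑ n 2 _ ⟩
    ∑∑ n (λ e e' → 2 * ⟦ ⌊ toℕ e <? toℕ e' ⌋ ∧ inv e e' ⟧)
      ≤⟨ ∑∑-mono-≤ n pair-≤ ⟩
    ∑∑ n (λ e e' → ⟦ ⌊ toℕ e <? toℕ e' ⌋ ⟧ * (W e e' + W e' e))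
      ≤⟨ ∑∑-ordered-≤ n W ⟩
    ∑∑ n W
      ≤⟨ ∑-mono-≤ n (λ e → ∑-weight-≤ {g = a} {h = b} a-fibres b-fibres (a e) (b e)) ⟩
    ∑[ e < n ] (4 * R * ∣ a e - b e ∣)
      ≡⟨ *-distribˡ-sum (4 * R) (λ e → ∣ a e - b e ∣) ⟨
    4 * R * ∑[ e < n ] ∣ a e - b e ∣
      ≡⟨ 4*R*D≡2*[2*R*D] R (∑[ e < n ] ∣ a e - b e ∣) ⟩
    2 * (2 * R * ∑[ e < n ] ∣ a e - b e ∣)
      ∎)
    where
    open ℕP.≤-Reasoning
    W : Fin n → Fin n → ℕ
    W e e' = weight (a e) (b e) (a e') (b e')
    pair-≤ : ∀ e e' → 2 * ⟦ ⌊ toℕ e <? toℕ e' ⌋ ∧ inv e e' ⟧ ≤ ⟦ ⌊ toℕ e <? toℕ e' ⌋ ⟧ * (W e e' + W e' e)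
    pair-≤ e e' = 2⟦∧⟧≤⟦⟧* ⌊ toℕ e <? toℕ e' ⌋ (inv e e') (W e e' + W e' e) (inverted⇒pairWeight≥2 ∘ inverted e e')
    4*R*D≡2*[2*R*D] : ∀ R D → 4 * R * D ≡ 2 * (2 * R * D)
    4*R*D≡2*[2*R*D] = solve-∀

open Counting using (∑∑; ∑⟦⌊⌋⟧-none; ΣℕΣℕ≡∑∑)
open Inversions using (FibresAtMost; T-inverted; inversions-≤)

open Data.Nat using (zero; suc; z≤n; s≤s; ∣_-_∣; _∸_; _≟_; _<?_; _≤?_; >-nonZero⁻¹)
  renaming (_≤_ to _≤ℕ_; _<_ to _<ℕ_; _+_ to _+ℕ_; _*_ to _*ℕ_)
open import Data.Integer as ℤ using (+_)
import Data.Integer.Properties as ℤP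
open import Data.Rational using (ℚ; 0ℚ; 1ℚ; _+_; _*_; _≤_; _/_; fromℚᵘ; Positive; nonNegative)
open import Data.Rational.Properties
  using ( toℚᵘ-injective; toℚᵘ-fromℚᵘ; fromℚᵘ-cong; toℚᵘ-homo-+; toℚᵘ-homo-*; toℚᵘ-mono-≤; toℚᵘ-cancel-≤
        ; normalize-pos; positive⁻¹; nonNegative⁻¹; nonNeg*nonNeg⇒nonNeg
        ; ≤-refl; ≤-reflexive; ≤-trans; <-irrefl; <-≤-trans; module ≤-Reasoning
        ; +-identityˡ; +-identityʳ; +-mono-≤; +-monoˡ-≤; +-monoʳ-≤
        ; *-identityʳ; *-zeroʳ; *-assoc; *-comm; *-distribˡ-+
        ; *-monoˡ-≤-nonNeg; *-monoʳ-≤-nonNeg; *-cancelˡ-≤-pos )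
  renaming (_≤?_ to _≤ℚ?_)
import Data.Rational.Unnormalised as ℚᵘ
open import Data.Rational.Unnormalised using (mkℚᵘ; *≡*; *≤*; _≃_)
import Data.Rational.Unnormalised.Properties as ℚᵘP

fromℚᵘ-homo-+ : ∀ p q → fromℚᵘ (p ℚᵘ.+ q) ≡ fromℚᵘ p + fromℚᵘ q
fromℚᵘ-homo-+ p q = toℚᵘ-injective (ℚᵘP.≃-trans (toℚᵘ-fromℚᵘ (p ℚᵘ.+ q)) (ℚᵘP.≃-sym
  (ℚᵘP.≃-trans (toℚᵘ-homo-+ (fromℚᵘ p) (fromℚᵘ q)) (ℚᵘP.+-cong (toℚᵘ-fromℚᵘ p) (toℚᵘ-fromℚᵘ q)))))

fromℚᵘ-homo-* : ∀ p q → fromℚᵘ (p ℚᵘ.* q) ≡ fromℚᵘ p * fromℚᵘ q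
fromℚᵘ-homo-* p q = toℚᵘ-injective (ℚᵘP.≃-trans (toℚᵘ-fromℚᵘ (p ℚᵘ.* q)) (ℚᵘP.≃-sym
  (ℚᵘP.≃-trans (toℚᵘ-homo-* (fromℚᵘ p) (fromℚᵘ q)) (ℚᵘP.*-cong (toℚᵘ-fromℚᵘ p) (toℚᵘ-fromℚᵘ q)))))

ι : ℕ → ℚ
ι k = + k / 1

ι-homo-+ : ∀ a b → ι (a +ℕ b) ≡ ι a + ι b
ι-homo-+ a b = trans (fromℚᵘ-cong {mkℚᵘ (+ (a +ℕ b)) 0} a+b≃) (fromℚᵘ-homo-+ (mkℚᵘ (+ a) 0) (mkℚᵘ (+ b) 0))
  where
  a+b≃ : mkℚᵘ (+ (a +ℕ b)) 0 ≃ mkℚᵘ (+ a) 0 ℚᵘ.+ mkℚᵘ (+ b) 0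
  a+b≃ = *≡* (cong (ℤ._* + 1) (trans (ℤP.pos-+ a b) (sym (cong₂ ℤ._+_ (ℤP.*-identityʳ (+ a)) (ℤP.*-identityʳ (+ b))))))

ι-homo-* : ∀ a b → ι (a *ℕ b) ≡ ι a * ι b
ι-homo-* a b = trans (fromℚᵘ-cong {mkℚᵘ (+ (a *ℕ b)) 0} {mkℚᵘ (+ a) 0 ℚᵘ.* mkℚᵘ (+ b) 0}
  (*≡* (cong (ℤ._* + 1) (ℤP.pos-* a b)))) (fromℚᵘ-homo-* (mkℚᵘ (+ a) 0) (mkℚᵘ (+ b) 0))

ι-*-/ : ∀ r .{{_ : NonZero r}} k → ι r * (+ k / r) ≡ ι k
ι-*-/ (suc r) k = trans (sym (fromℚᵘ-homo-* (mkℚᵘ (+ suc r) 0) (mkℚᵘ (+ k) r))) (fromℚᵘ-cong {_} {mkℚᵘ (+ k) 0} r*k/r≃k)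
  where
  r*k/r≃k : mkℚᵘ (+ suc r) 0 ℚᵘ.* mkℚᵘ (+ k) r ≃ mkℚᵘ (+ k) 0
  r*k/r≃k = *≡* (trans (ℤP.*-identityʳ _) (trans (ℤP.*-comm (+ suc r) (+ k))
    (cong (λ m → + k ℤ.* + suc m) (sym (ℕP.+-identityʳ r)))))

ι-mono-≤ : ∀ {a b} → a ≤ℕ b → ι a ≤ ι b
ι-mono-≤ {a} {b} a≤b = toℚᵘ-cancel-≤ (ℚᵘP.≤-respˡ-≃ (ℚᵘP.≃-sym (toℚᵘ-fromℚᵘ (mkℚᵘ (+ a) 0)))
  (ℚᵘP.≤-respʳ-≃ (ℚᵘP.≃-sym (toℚᵘ-fromℚᵘ (mkℚᵘ (+ b) 0)))
    (*≤* (ℤP.*-monoʳ-≤-nonNeg (+ 1) (ℤ.+≤+ a≤b)))))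

ι-cancel-≤ : ∀ {a b} → ι a ≤ ι b → a ≤ℕ b
ι-cancel-≤ {a} {b} ιa≤ιb with ℚᵘP.≤-respˡ-≃ (toℚᵘ-fromℚᵘ (mkℚᵘ (+ a) 0))
  (ℚᵘP.≤-respʳ-≃ (toℚᵘ-fromℚᵘ (mkℚᵘ (+ b) 0)) (toℚᵘ-mono-≤ ιa≤ιb))
... | *≤* a*1≤b*1 = ℤP.drop‿+≤+ (ℤP.*-cancelʳ-≤-pos (+ a) (+ b) (+ 1) a*1≤b*1)

ι-nonNeg : ∀ k → 0ℚ ≤ ι k
ι-nonNeg k = ι-mono-≤ {0} {k} z≤n

0≤*0≤ : ∀ {x y} → 0ℚ ≤ x → 0ℚ ≤ y → 0ℚ ≤ x * y
0≤*0≤ {x} {y} 0≤x 0≤y = nonNegative⁻¹ (x * y) {{nonNeg*nonNeg⇒nonNeg x {{nonNegative 0≤x}} y {{nonNegative 0≤y}}}}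

instance
  ι-positive : ∀ {r} .{{_ : NonZero r}} → Positive (ι r)
  ι-positive {suc r} = normalize-pos (suc r) 1

Σ-cong : ∀ n {f g : Fin n → ℚ} → (∀ i → f i ≡ g i) → Σ n f ≡ Σ n g
Σ-cong zero    f≡g = refl
Σ-cong (suc n) f≡g = cong₂ _+_ (f≡g Fin.zero) (Σ-cong n (f≡g ∘ Fin.suc))

Σ-mono-≤ : ∀ n {f g : Fin n → ℚ} → (∀ i → f i ≤ g i) → Σ n f ≤ Σ n g
Σ-mono-≤ zero    f≤g = ≤-refl
Σ-mono-≤ (suc n) f≤g = +-mono-≤ (f≤g Fin.zero) (Σ-mono-≤ n (f≤g ∘ Fin.suc))

Σ-zero : ∀ n → Σ n (λ _ → 0ℚ) ≡ 0ℚ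
Σ-zero zero    = refl
Σ-zero (suc n) = trans (+-identityˡ _) (Σ-zero n)

Σ-nonNeg : ∀ n {f : Fin n → ℚ} → (∀ i → 0ℚ ≤ f i) → 0ℚ ≤ Σ n f
Σ-nonNeg n {f} 0≤f = subst (_≤ Σ n f) (Σ-zero n) (Σ-mono-≤ n 0≤f)

Σ-nonPos : ∀ n {f : Fin n → ℚ} → (∀ i → f i ≤ 0ℚ) → Σ n f ≤ 0ℚ
Σ-nonPos n {f} f≤0 = subst (Σ n f ≤_) (Σ-zero n) (Σ-mono-≤ n f≤0)

term≤Σ : ∀ n {f : Fin n → ℚ} → (∀ i → 0ℚ ≤ f i) → ∀ k → f k ≤ Σ n f
term≤Σ (suc n) {f} 0≤f Fin.zero =
  subst (_≤ Σ (suc n) f) (+-identityʳ (f Fin.zero)) (+-monoʳ-≤ (f Fin.zero) (Σ-nonNeg n (0≤f ∘ Fin.suc)))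
term≤Σ (suc n) {f} 0≤f (Fin.suc k) =
  ≤-trans (term≤Σ n (0≤f ∘ Fin.suc) k) (subst (_≤ Σ (suc n) f) (+-identityˡ _) (+-monoˡ-≤ _ (0≤f Fin.zero)))

*-distribˡ-Σ : ∀ n c (f : Fin n → ℚ) → c * Σ n f ≡ Σ n (λ i → c * f i)
*-distribˡ-Σ zero    c f = *-zeroʳ c
*-distribˡ-Σ (suc n) c f = trans (*-distribˡ-+ c _ _) (cong (λ s → c * f Fin.zero + s) (*-distribˡ-Σ n c (f ∘ Fin.suc)))

ι-homo-∑ : ∀ n (g : Fin n → ℕ) → ι (∑[ i < n ] g i) ≡ Σ n (λ i → ι (g i))
ι-homo-∑ zero    g = refl
ι-homo-∑ (suc n) g = trans (ι-homo-+ (g Fin.zero) _) (cong (λ s → ι (g Fin.zero) + s) (ι-homo-∑ n (g ∘ Fin.suc)))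

module _ (r : ℕ) .{{_ : NonZero r}} where

  1/r≰0 : ¬ (+ 1 / r ≤ 0ℚ)
  1/r≰0 = <-irrefl refl ∘ <-≤-trans (positive⁻¹ (+ 1 / r) {{normalize-pos 1 r}})

  /-mono-≤ : ∀ {j k} → j ≤ℕ k → + j / r ≤ + k / r
  /-mono-≤ {j} {k} j≤k = *-cancelˡ-≤-pos (ι r) (subst₂ _≤_ (sym (ι-*-/ r j)) (sym (ι-*-/ r k)) (ι-mono-≤ j≤k))

  0/r≤0 : + 0 / r ≤ 0ℚ
  0/r≤0 = *-cancelˡ-≤-pos (ι r) (≤-reflexive (trans (ι-*-/ r 0) (sym (*-zeroʳ (ι r)))))

  k/r≤0⊎1/r≤k/r : ∀ k → + k / r ≤ 0ℚ ⊎ + 1 / r ≤ + k / r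
  k/r≤0⊎1/r≤k/r zero    = inj₁ 0/r≤0
  k/r≤0⊎1/r≤k/r (suc k) = inj₂ (/-mono-≤ (s≤s z≤n))

  1/r≤1 : + 1 / r ≤ 1ℚ
  1/r≤1 = *-cancelˡ-≤-pos (ι r) (subst₂ _≤_ (sym (ι-*-/ r 1)) (sym (*-identityʳ (ι r))) (ι-mono-≤ (>-nonZero⁻¹ r)))

  1/r≤⇒1≤r* : ∀ {x} → + 1 / r ≤ x → 1ℚ ≤ ι r * x
  1/r≤⇒1≤r* {x} 1/r≤x = subst (_≤ ι r * x) (ι-*-/ r 1) (*-monoˡ-≤-nonNeg (ι r) {{nonNegative (ι-nonNeg r)}} 1/r≤x)

firstFrom1-least : ∀ m (p : ℕ → Bool) {i} → 1 ≤ℕ i → T (p i) → firstFrom1 m p ≤ℕ i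
firstFrom1-least zero    p {suc i}       _ _   = s≤s z≤n
firstFrom1-least (suc m) p {suc zero}    _ p1  with p 1
... | true  = s≤s z≤n
... | false = ⊥-elim p1
firstFrom1-least (suc m) p {suc (suc i)} _ pi with p 1
... | true  = s≤s z≤n
... | false = s≤s (firstFrom1-least m (p ∘ suc) (s≤s z≤n) pi)

firstFrom1-holds : ∀ m (p : ℕ → Bool) {i} → 1 ≤ℕ i → i ≤ℕ m → T (p i) → T (p (firstFrom1 m p))
firstFrom1-holds (suc m) p {suc zero} _ _ p1 with p 1 in p1≡
... | true  = subst T (sym p1≡) tt
... | false = ⊥-elim p1
firstFrom1-holds (suc m) p {suc (suc i)} _ (s≤s i≤m) pi with p 1 in p1≡
... | true  = subst T (sym p1≡) tt
... | false = firstFrom1-holds m (p ∘ suc) (s≤s z≤n) i≤m pi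

firstFrom1-positive : ∀ m (p : ℕ → Bool) → 1 ≤ℕ firstFrom1 m p
firstFrom1-positive zero    p = s≤s z≤n
firstFrom1-positive (suc m) p with p 1
... | true  = s≤s z≤n
... | false = s≤s z≤n

fromPosition : ∀ {k n} → 1 ≤ℕ k → k ≤ℕ n → Σ[ c ∈ Fin n ] suc (toℕ c) ≡ k
fromPosition {suc k} _ k<n = Fin.fromℕ< k<n , cong suc (FinP.toℕ-fromℕ< k<n)

∑⟦⌊⌋⟧≤ : ∀ r .{{_ : NonZero r}} n {P : Fin n → Set} (p : ∀ i → Dec (P i)) (x : Fin n → ℚ) →
          (∀ i → 0ℚ ≤ x i) → Σ n x ≡ 1ℚ → (∀ i → P i → 1ℚ ≤ ι r * x i) → ∑[ i < n ] ⟦ ⌊ p i ⌋ ⟧ ≤ℕ r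
∑⟦⌊⌋⟧≤ r n p x 0≤x Σx≡1 P⇒1≤rx = ι-cancel-≤ (begin
  ι (∑[ i < n ] ⟦ ⌊ p i ⌋ ⟧)  ≡⟨ ι-homo-∑ n (λ i → ⟦ ⌊ p i ⌋ ⟧) ⟩
  Σ n (λ i → ι ⟦ ⌊ p i ⌋ ⟧)   ≤⟨ Σ-mono-≤ n ι⟦p⟧≤rx ⟩
  Σ n (λ i → ι r * x i)       ≡⟨ *-distribˡ-Σ n (ι r) x ⟨
  ι r * Σ n x                 ≡⟨ cong (ι r *_) Σx≡1 ⟩
  ι r * 1ℚ                    ≡⟨ *-identityʳ (ι r) ⟩
  ι r                         ∎)
  where
  open ≤-Reasoning
  ι⟦p⟧≤rx : ∀ i → ι ⟦ ⌊ p i ⌋ ⟧ ≤ ι r * x i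
  ι⟦p⟧≤rx i with p i
  ... | yes Pi = P⇒1≤rx i Pi
  ... | no _   = 0≤*0≤ (ι-nonNeg r) (0≤x i)

transport-cost-≥ : ∀ n (v : Fin n → ℚ) m q → m ≤ℕ q → (∀ j → 0ℚ ≤ v j) →
                   (∀ j → toℕ j <ℕ q → v j ≤ 0ℚ) →
                   ι (q ∸ m) * Σ n v ≤ Σ n (λ j → ι ∣ toℕ j - m ∣ * v j)
transport-cost-≥ n v m q m≤q 0≤v v≤0 = begin
  ι (q ∸ m) * Σ n v             ≡⟨ *-distribˡ-Σ n (ι (q ∸ m)) v ⟩
  Σ n (λ j → ι (q ∸ m) * v j)   ≤⟨ Σ-mono-≤ n pointwise ⟩
  Σ n (λ j → ι ∣ toℕ j - m ∣ * v j) ∎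
  where
  open ≤-Reasoning
  pointwise : ∀ j → ι (q ∸ m) * v j ≤ ι ∣ toℕ j - m ∣ * v j
  pointwise j with toℕ j <? q
  ... | yes j<q = ≤-trans (subst (ι (q ∸ m) * v j ≤_) (*-zeroʳ (ι (q ∸ m)))
                            (*-monoˡ-≤-nonNeg (ι (q ∸ m)) {{nonNegative (ι-nonNeg (q ∸ m))}} (v≤0 j j<q)))
                          (0≤*0≤ (ι-nonNeg ∣ toℕ j - m ∣) (0≤v j))
  ... | no j≮q = *-monoʳ-≤-nonNeg (v j) {{nonNegative (0≤v j)}} (ι-mono-≤ (subst (q ∸ m ≤ℕ_)
                   (sym (ℕP.m≤n⇒∣n-m∣≡n∸m (ℕP.≤-trans m≤q q≤j))) (ℕP.∸-monoˡ-≤ m q≤j)))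
    where
    q≤j = ℕP.≮⇒≥ j≮q

≤-rescale : ∀ r d {x y} → 1ℚ ≤ ι r * x → ι d * x ≤ y → ι d ≤ ι r * y
≤-rescale r d {x} {y} 1≤rx dx≤y = begin
  ι d             ≡⟨ *-identityʳ (ι d) ⟨
  ι d * 1ℚ        ≤⟨ *-monoˡ-≤-nonNeg (ι d) {{nonNegative (ι-nonNeg d)}} 1≤rx ⟩
  ι d * (ι r * x) ≡⟨ trans (sym (*-assoc (ι d) (ι r) x)) (trans (cong (_* x) (*-comm (ι d) (ι r))) (*-assoc (ι r) (ι d) x)) ⟩
  ι r * (ι d * x) ≤⟨ *-monoˡ-≤-nonNeg (ι r) {{nonNegative (ι-nonNeg r)}} dx≤y ⟩
  ι r * y         ∎
  where open ≤-Reasoning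

if-⌊⌋-elim : ∀ {P A : Set} (R : A → Set) (d : Dec P) {x y : A} → (P → R x) → R y → R (if ⌊ d ⌋ then x else y)
if-⌊⌋-elim R (yes p) Rx _  = Rx p
if-⌊⌋-elim R (no _)  _  Ry = Ry

if-⌊⌋-yes : ∀ {P A : Set} (d : Dec P) {x y : A} → P → (if ⌊ d ⌋ then x else y) ≡ x
if-⌊⌋-yes (yes _) _ = refl
if-⌊⌋-yes (no ¬p) p = contradiction p ¬p

module RIndex (r : ℕ) .{{_ : NonZero r}} {n : ℕ} (M : Matrix n)
              (M-ds : DoublyStochastic n M) (M-mult : EntriesMultipleOf1/ r n M) where

  private
    M-nonNeg    = proj₁ M-ds
    M-rowSum    = proj₁ (proj₂ M-ds)
    M-columnSum = proj₂ (proj₂ M-ds)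

  entry≤0⊎1/r≤entry : ∀ e s → M e s ≤ 0ℚ ⊎ + 1 / r ≤ M e s
  entry≤0⊎1/r≤entry e s with M-mult e s
  ... | k , Mes≡k/r rewrite Mes≡k/r = k/r≤0⊎1/r≤k/r r k

  entry≤prefix : ∀ e s {i} → suc (toℕ s) ≤ℕ i → M e s ≤ prefix n M e i
  entry≤prefix e s {i} s<i = subst (_≤ prefix n M e i) (if-⌊⌋-yes (suc (toℕ s) ≤? i) s<i)
    (term≤Σ n (λ s' → if-⌊⌋-elim (0ℚ ≤_) (suc (toℕ s') ≤? i) (λ _ → M-nonNeg e s') ≤-refl) s)

  prefix-full : ∀ e → prefix n M e n ≡ 1ℚ
  prefix-full e = trans (Σ-cong n (λ s → if-⌊⌋-yes (suc (toℕ s) ≤? n) (FinP.toℕ<n s))) (M-rowSum e)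

  prefix≤0 : ∀ e i → (∀ s → suc (toℕ s) ≤ℕ i → M e s ≤ 0ℚ) → prefix n M e i ≤ 0ℚ
  prefix≤0 e i M≤0 = Σ-nonPos n (λ s → if-⌊⌋-elim (_≤ 0ℚ) (suc (toℕ s) ≤? i) (M≤0 s) ≤-refl)

  I : Fin n → ℕ
  I = rIndex r n M

  private
    reaches : Fin n → ℕ → Bool
    reaches e i = ⌊ + 1 / r ≤ℚ? prefix n M e i ⌋

  I-least : ∀ e {i} → 1 ≤ℕ i → + 1 / r ≤ prefix n M e i → I e ≤ℕ i
  I-least e 1≤i h = firstFrom1-least n (reaches e) 1≤i (fromWitness h)

  private
    1≤n : Fin n → 1 ≤ℕ n
    1≤n e = ℕP.≤-trans (s≤s z≤n) (FinP.toℕ<n e)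

    1/r≤prefix-full : ∀ e → + 1 / r ≤ prefix n M e n
    1/r≤prefix-full e = subst (+ 1 / r ≤_) (sym (prefix-full e)) (1/r≤1 r)

  I≤n : ∀ e → I e ≤ℕ n
  I≤n e = I-least e (1≤n e) (1/r≤prefix-full e)

  I-reached : ∀ e → + 1 / r ≤ prefix n M e (I e)
  I-reached e = toWitness (firstFrom1-holds n (reaches e) (1≤n e) ℕP.≤-refl (fromWitness (1/r≤prefix-full e)))

  I-positive : ∀ e → 1 ≤ℕ I e
  I-positive e = firstFrom1-positive n (reaches e)

  position : Fin n → Fin n
  position e = proj₁ (fromPosition (I-positive e) (I≤n e))

  suc-position : ∀ e → suc (toℕ (position e)) ≡ I e
  suc-position e = proj₂ (fromPosition (I-positive e) (I≤n e))

  position-unique : ∀ e k → I e ≡ suc (toℕ k) → position e ≡ k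
  position-unique e k Ie≡1+k = FinP.toℕ-injective (ℕP.suc-injective (trans (suc-position e) Ie≡1+k))

  entry-before-I : ∀ e s → suc (toℕ s) <ℕ I e → M e s ≤ 0ℚ
  entry-before-I e s s<I with entry≤0⊎1/r≤entry e s
  ... | inj₁ Mes≤0   = Mes≤0
  ... | inj₂ 1/r≤Mes = contradiction (I-least e (s≤s z≤n) (≤-trans 1/r≤Mes (entry≤prefix e s ℕP.≤-refl))) (ℕP.<⇒≱ s<I)

  -- The prefix up to I e reaches 1/r, so its last entry cannot vanish.
  entry-at-I : ∀ e → 1ℚ ≤ ι r * M e (position e)
  entry-at-I e = Sum.[_,_]′ impossible (1/r≤⇒1≤r* r) (entry≤0⊎1/r≤entry e (position e))
    where
    impossible : M e (position e) ≤ 0ℚ → 1ℚ ≤ ι r * M e (position e)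
    impossible Mep≤0 = contradiction (≤-trans (I-reached e) (prefix≤0 e (I e) up-to-I≤0)) (1/r≰0 r)
      where
      up-to-I≤0 : ∀ s → suc (toℕ s) ≤ℕ I e → M e s ≤ 0ℚ
      up-to-I≤0 s s+1≤I = Sum.[ entry-before-I e s , at-position ]′ (ℕP.m≤n⇒m<n∨m≡n s+1≤I)
        where
        at-position : suc (toℕ s) ≡ I e → M e s ≤ 0ℚ
        at-position s+1≡I = subst (λ s → M e s ≤ 0ℚ) (position-unique e s (sym s+1≡I)) Mep≤0

  I-fibres : FibresAtMost r I
  I-fibres zero    = ℕP.≤-trans (ℕP.≤-reflexive (∑⟦⌊⌋⟧-none n _ (λ e → ℕP.<⇒≢ (I-positive e) ∘ sym))) z≤n
  I-fibres (suc c) = fibre (c <? n)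
    where
    fibre : Dec (c <ℕ n) → ∑[ e < n ] ⟦ ⌊ I e ≟ suc c ⌋ ⟧ ≤ℕ r
    fibre (yes c<n) = ∑⟦⌊⌋⟧≤ r n (λ e → I e ≟ suc c) (λ e → M e k) (λ e → M-nonNeg e k) (M-columnSum k) at-k
      where
      k = Fin.fromℕ< c<n
      at-k : ∀ e → I e ≡ suc c → 1ℚ ≤ ι r * M e k
      at-k e Ie≡1+c = subst (λ s → 1ℚ ≤ ι r * M e s)
        (position-unique e k (trans Ie≡1+c (cong suc (sym (FinP.toℕ-fromℕ< c<n))))) (entry-at-I e)
    fibre (no c≮n) =
      ℕP.≤-trans (ℕP.≤-reflexive (∑⟦⌊⌋⟧-none n _ (λ e Ie≡1+c → c≮n (subst (_≤ℕ n) Ie≡1+c (I≤n e))))) z≤n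

module Transport (r : ℕ) .{{_ : NonZero r}} {n : ℕ} (A B : Matrix n)
                 (A-ds : DoublyStochastic n A) (B-ds : DoublyStochastic n B)
                 (A-mult : EntriesMultipleOf1/ r n A) (B-mult : EntriesMultipleOf1/ r n B)
                 (f : Flow n) (f-feasible : FeasibleFlow n A B f) where

  module IA = RIndex r A A-ds A-mult
  module IB = RIndex r B B-ds B-mult

  private
    f-nonNeg  = proj₁ f-feasible
    f-columns = proj₁ (proj₂ f-feasible)
    f-rows    = proj₂ (proj₂ f-feasible)

  cost : Fin n → ℚ
  cost e = Σ n (λ i → Σ n (λ j → ι ∣ toℕ i - toℕ j ∣ * f e i j))

  private
    cost-term-nonNeg : ∀ e i j → 0ℚ ≤ ι ∣ toℕ i - toℕ j ∣ * f e i j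
    cost-term-nonNeg e i j = 0≤*0≤ (ι-nonNeg ∣ toℕ i - toℕ j ∣) (f-nonNeg e i j)

  gap≤r*cost : ∀ e → ι ∣ IA.I e - IB.I e ∣ ≤ ι r * cost e
  gap≤r*cost e = subst₂ (λ a b → ι ∣ a - b ∣ ≤ ι r * cost e) (IA.suc-position e) (IB.suc-position e)
    (Sum.[_,_]′ p≤q q≤p (ℕP.≤-total (toℕ p) (toℕ q)))
    where
    open ≤-Reasoning
    p = IA.position e
    q = IB.position e

    B-vanishes-before-q : ∀ j → toℕ j <ℕ toℕ q → f e p j ≤ 0ℚ
    B-vanishes-before-q j j<q = ≤-trans (term≤Σ n (λ i → f-nonNeg e i j) p)
      (subst (_≤ 0ℚ) (sym (f-columns e j))
        (IB.entry-before-I e j (subst (suc (toℕ j) <ℕ_) (IB.suc-position e) (s≤s j<q))))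

    A-vanishes-before-p : ∀ i → toℕ i <ℕ toℕ p → f e i q ≤ 0ℚ
    A-vanishes-before-p i i<p = ≤-trans (term≤Σ n (f-nonNeg e i) q)
      (subst (_≤ 0ℚ) (sym (f-rows e i))
        (IA.entry-before-I e i (subst (suc (toℕ i) <ℕ_) (IA.suc-position e) (s≤s i<p))))

    row-cost : toℕ p ≤ℕ toℕ q → ι (toℕ q ∸ toℕ p) * A e p ≤ cost e
    row-cost p≤q = begin
      ι (toℕ q ∸ toℕ p) * A e p                  ≡⟨ cong (ι (toℕ q ∸ toℕ p) *_) (f-rows e p) ⟨
      ι (toℕ q ∸ toℕ p) * Σ n (f e p)            ≤⟨ transport-cost-≥ n (f e p) (toℕ p) (toℕ q) p≤q
                                                      (f-nonNeg e p) B-vanishes-before-q ⟩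
      Σ n (λ j → ι ∣ toℕ j - toℕ p ∣ * f e p j)  ≡⟨ Σ-cong n (λ j → cong (λ d → ι d * f e p j)
                                                                      (ℕP.∣-∣-comm (toℕ j) (toℕ p))) ⟩
      Σ n (λ j → ι ∣ toℕ p - toℕ j ∣ * f e p j)  ≤⟨ term≤Σ n (λ i → Σ-nonNeg n (cost-term-nonNeg e i)) p ⟩
      cost e                                     ∎

    column-cost : toℕ q ≤ℕ toℕ p → ι (toℕ p ∸ toℕ q) * B e q ≤ cost e
    column-cost q≤p = begin
      ι (toℕ p ∸ toℕ q) * B e q                  ≡⟨ cong (ι (toℕ p ∸ toℕ q) *_) (f-columns e q) ⟨
      ι (toℕ p ∸ toℕ q) * Σ n (λ i → f e i q)    ≤⟨ transport-cost-≥ n (λ i → f e i q) (toℕ q) (toℕ p) q≤p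
                                                      (λ i → f-nonNeg e i q) A-vanishes-before-p ⟩
      Σ n (λ i → ι ∣ toℕ i - toℕ q ∣ * f e i q)  ≤⟨ Σ-mono-≤ n (λ i → term≤Σ n (cost-term-nonNeg e i) q) ⟩
      cost e                                     ∎

    p≤q : toℕ p ≤ℕ toℕ q → ι ∣ toℕ p - toℕ q ∣ ≤ ι r * cost e
    p≤q p≤q = subst (λ d → ι d ≤ ι r * cost e) (sym (ℕP.m≤n⇒∣m-n∣≡n∸m p≤q))
      (≤-rescale r (toℕ q ∸ toℕ p) (IA.entry-at-I e) (row-cost p≤q))

    q≤p : toℕ q ≤ℕ toℕ p → ι ∣ toℕ p - toℕ q ∣ ≤ ι r * cost e
    q≤p q≤p = subst (λ d → ι d ≤ ι r * cost e) (sym (ℕP.m≤n⇒∣n-m∣≡n∸m q≤p))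
      (≤-rescale r (toℕ p ∸ toℕ q) (IB.entry-at-I e) (column-cost q≤p))

  ∑gap≤r*flowCost : ι (∑[ e < n ] ∣ IA.I e - IB.I e ∣) ≤ ι r * flowCost n f
  ∑gap≤r*flowCost = begin
    ι (∑[ e < n ] ∣ IA.I e - IB.I e ∣)   ≡⟨ ι-homo-∑ n (λ e → ∣ IA.I e - IB.I e ∣) ⟩
    Σ n (λ e → ι ∣ IA.I e - IB.I e ∣)    ≤⟨ Σ-mono-≤ n gap≤r*cost ⟩
    Σ n (λ e → ι r * cost e)             ≡⟨ *-distribˡ-Σ n (ι r) cost ⟨
    ι r * flowCost n f                   ∎
    where open ≤-Reasoning

≤2rD∧D≤rc⇒≤2r²c : ∀ r k D c → k ≤ℕ 2 *ℕ r *ℕ D → ι D ≤ ι r * c →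
                   ι k ≤ ι (2 *ℕ (r *ℕ r)) * c
≤2rD∧D≤rc⇒≤2r²c r k D c k≤2rD D≤rc = begin
  ι k                          ≤⟨ ι-mono-≤ k≤2rD ⟩
  ι (2 *ℕ r *ℕ D)              ≡⟨ ι-homo-* (2 *ℕ r) D ⟩
  ι (2 *ℕ r) * ι D             ≤⟨ *-monoˡ-≤-nonNeg (ι (2 *ℕ r)) {{nonNegative (ι-nonNeg (2 *ℕ r))}} D≤rc ⟩
  ι (2 *ℕ r) * (ι r * c)       ≡⟨ *-assoc (ι (2 *ℕ r)) (ι r) c ⟨
  ι (2 *ℕ r) * ι r * c         ≡⟨ cong (_* c) (trans (sym (ι-homo-* (2 *ℕ r) r)) (cong ι (ℕP.*-assoc 2 r r))) ⟩
  ι (2 *ℕ (r *ℕ r)) * c        ∎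
  where open ≤-Reasoning

lemma25 : (r : ℕ) .{{_ : NonZero r}} (n : ℕ) (A B : Matrix n) →
    DoublyStochastic n A → DoublyStochastic n B →
    EntriesMultipleOf1/ r n A → EntriesMultipleOf1/ r n B →
    (f : Flow n) → FeasibleFlow n A B f →
    (+ dKT r n A B) / 1 ≤ ((+ (2 Data.Nat.* (r Data.Nat.* r))) / 1) * flowCost n f
-- The instance is bound and passed on explicitly: otherwise Agda compares dKT with the goal by unfolding it.
lemma25 r {{r≢0}} n A B A-ds B-ds A-mult B-mult f f-feasible =
  ≤2rD∧D≤rc⇒≤2r²c r (dKT r {{r≢0}} n A B) D (flowCost n f) dKT≤2rD ∑gap≤r*flowCost
  where
  open Transport r A B A-ds B-ds A-mult B-mult f f-feasible
  D : ℕ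
  D = ∑[ e < n ] ∣ IA.I e - IB.I e ∣
  dKT≤2rD : dKT r {{r≢0}} n A B ≤ℕ 2 *ℕ r *ℕ D
  dKT≤2rD = subst (_≤ℕ 2 *ℕ r *ℕ D) (sym (ΣℕΣℕ≡∑∑ n (λ e e' → ⟦ ⌊ toℕ e <? toℕ e' ⌋ ∧ inverted r n A B e e' ⟧)))
    (inversions-≤ r IA.I IB.I (inverted r n A B) IA.I-fibres IB.I-fibres
      (λ e e' → T-inverted (IA.I e) (IA.I e') (IB.I e) (IB.I e')))
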